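{- Let $G=(V,E)$ be an undirected graph (parallel edges allowed) with terminals $s,t$ such that every vertex and every edge of $G$ lies on some $s$-$t$ path. Then every feedback edge set $F\subseteq E$ of $G$ is a tracking edge set for $(G,s,t)$.
   Context: A feedback edge set is a set of edges whose removal makes the graph acyclic. An $s$-$t$ path is a simple path from $s$ to $t$ (specified by its sequence of edges). A set $T\subseteq E$ is a tracking edge set if for any two distinct $s$-$t$ paths $P_1,P_2$, the sequence of edges of $T\cap E(P_1)$ in the order along $P_1$ differs from the sequence of edges of $T\cap E(P_2)$ in the order along $P_2$. -}

module Defs where

open import Data.Nat using (ℕ)
open import Data.Fin using (Fin)
open import Data.Fin.Subset using (Subset; _∈_; _∉_)
open import Data.Fin.Subset.Properties using (_∈?_)
open import Data.List using (List; []; _∷_; filter)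
open import Data.List.Relation.Unary.All using (All)
open import Data.List.Relation.Unary.Unique.Propositional using (Unique)
import Data.List.Membership.Propositional as LM
open import Data.Product using (_×_; _,_; Σ; ∃)
open import Data.Sum using (_⊎_)
open import Relation.Binary.PropositionalEquality using (_≡_)
open import Relation.Nullary using (¬_)
open import Data.Empty using (⊥)

-- A finite undirected multigraph: vertices Fin n, edges Fin m (so parallel
-- edges are allowed), each edge has an (unordered) pair of endpoints,
-- given as an ordered pair whose orientation is irrelevant.
record Graph : Set where
  field
    n    : ℕ
    m    : ℕ
    ends : Fin m → Fin n × Fin n

module _ (G : Graph) where
  open Graph G

  V : Set
  V = Fin n

  E : Set
  E = Fin m

  Joins : E → V → V → Set
  Joins e u w = ends e ≡ (u , w) ⊎ ends e ≡ (w , u)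

  data Walk : V → V → Set where
    []   : ∀ {u} → Walk u u
    step : ∀ {u w v} (e : E) → Joins e u w → Walk w v → Walk u v

  edges : ∀ {u v} → Walk u v → List E
  edges []             = []
  edges (step e _ p)   = e ∷ edges p

  verts : ∀ {u v} → Walk u v → List V
  verts {u} []           = u ∷ []
  verts {u} (step _ _ p) = u ∷ verts p

  IsPath : ∀ {u v} → Walk u v → Set
  IsPath p = Unique (verts p)

  record Path (u v : V) : Set where
    constructor path
    field
      walk   : Walk u v
      simple : IsPath walk
  open Path public

  tailVerts : ∀ {u v} → Walk u v → List V
  tailVerts []           = []
  tailVerts (step _ _ p) = verts p

  -- a cycle: a nonempty closed walk v₀ e₁ v₁ … e_k v_k = v₀ with pairwise
  -- distinct edges and pairwise distinct vertices v₁ … v_k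
  -- (covers loops (k = 1) and pairs of parallel edges (k = 2))
  IsCycle : ∀ {u} → Walk u u → Set
  IsCycle []               = ⊥
  IsCycle c@(step _ _ _)   = Unique (edges c) × Unique (tailVerts c)

  FeedbackEdgeSet : Subset m → Set
  FeedbackEdgeSet F =
    ∀ {u} (c : Walk u u) → IsCycle c → All (λ e → e ∉ F) (edges c) → ⊥

  trace : Subset m → ∀ {u v} → Walk u v → List E
  trace T p = filter (λ e → e ∈? T) (edges p)

  TrackingEdgeSet : Subset m → V → V → Set
  TrackingEdgeSet T s t =
    (P₁ P₂ : Path s t) →
    ¬ (edges (walk P₁) ≡ edges (walk P₂)) →
    ¬ (trace T (walk P₁) ≡ trace T (walk P₂))

  Covered : V → V → Set
  Covered s t =
    (∀ (x : V) → Σ (Path s t) λ P → x LM.∈ verts (walk P)) ×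
    (∀ (e : E) → Σ (Path s t) λ P → e LM.∈ edges (walk P))

-- Let P and Q be s-t paths with the same F-trace. An F-edge of either path
-- occurs in its trace, hence in the other path, so the symmetric difference D
-- of their edge sets avoids F. A simple path uses at most two edges at a
-- vertex, one at s and t, and two at every other vertex it passes; comparing
-- P and Q at an endpoint of a D-edge always produces a second D-edge there.
-- A nonempty edge set without degree-one vertices contains a cycle, which
-- would survive the deletion of F, so D is empty; and two simple s-t paths
-- with the same edge set traverse it in the same order.
module Submission where

open import Defs
open import Data.Nat using (ℕ; zero; suc; _+_; _<_; _≤_; z<s)
open import Data.Nat.Properties using (_≤?_; ≰⇒>; <⇒≱; +-suc; m<m+n; ≤-pred)
open import Data.Fin as Fin using (Fin; zero; suc)
open import Data.Fin.Properties using (_≟_; pigeonhole)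
open import Data.Fin.Subset as Subset using (Subset)
open import Data.Fin.Subset.Properties using () renaming (_∈?_ to _∈?ₛ_)
open import Data.List using (List; []; _∷_; length; lookup)
open import Data.List.Relation.Unary.All as All using (All; []; _∷_)
open import Data.List.Relation.Unary.All.Properties using (¬Any⇒All¬; anti-mono)
open import Data.List.Relation.Unary.Any using (here; there; any?)
open import Data.List.Relation.Unary.AllPairs using ([]; _∷_) renaming (tail to Unique-tail)
open import Data.List.Relation.Unary.Unique.Propositional using (Unique)
open import Data.List.Relation.Unary.Unique.Propositional.Properties using (Unique[x∷xs]⇒x∉xs)
open import Data.List.Membership.Propositional using (_∈_; _∉_)
open import Data.List.Membership.Propositional.Properties using (∈-lookup; ∈-filter⁺; ∈-filter⁻)
open import Data.List.Relation.Binary.Subset.Propositional using (_⊆_)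
open import Data.Product using (_×_; _,_; Σ; ∃; ∃₂; proj₁; proj₂)
open import Data.Product.Properties using (,-injective)
open import Data.Sum using (_⊎_; inj₁; inj₂)
open import Data.Empty using (⊥; ⊥-elim)
open import Relation.Nullary using (¬_; Dec; yes; no)
open import Relation.Binary.PropositionalEquality using (_≡_; _≢_; ≢-sym; refl; sym; trans; cong; subst)

_∈?_ : ∀ {k} (i : Fin k) (is : List (Fin k)) → Dec (i ∈ is)
i ∈? is = any? (i ≟_) is

Unique-lookup-distinct : ∀ {A : Set} {xs : List A} → Unique xs →
                         ∀ {i j} → i Fin.< j → lookup xs i ≢ lookup xs j
Unique-lookup-distinct (x∉xs ∷ _)     {zero}  {suc j} _   = All.lookup x∉xs (∈-lookup j)
Unique-lookup-distinct (_ ∷ xs-unique) {suc i} {suc j} i<j =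
  Unique-lookup-distinct xs-unique (≤-pred i<j)

Unique-length≤ : ∀ {k} {xs : List (Fin k)} → Unique xs → length xs ≤ k
Unique-length≤ {k} {xs} xs-unique with length xs ≤? k
... | yes length≤k = length≤k
... | no length≰k with i , j , i<j , eq ← pigeonhole (≰⇒> length≰k) (lookup xs) =
  ⊥-elim (Unique-lookup-distinct xs-unique i<j eq)

module _ (G : Graph) where
  open Graph G using (n; ends)

  private variable
    s t u v w x y a b y₁ y₂ y₃ : V G
    e e′ e₁ e₂ e₃ : E G

  Joins-sym : Joins G e u w → Joins G e w u
  Joins-sym (inj₁ p) = inj₂ p
  Joins-sym (inj₂ p) = inj₁ p

  Joins-endpoint : Joins G e u w → Joins G e a b → a ≡ u ⊎ a ≡ w
  Joins-endpoint (inj₁ p) (inj₁ q) = inj₁ (proj₁ (,-injective (trans (sym q) p)))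
  Joins-endpoint (inj₁ p) (inj₂ q) = inj₂ (proj₂ (,-injective (trans (sym q) p)))
  Joins-endpoint (inj₂ p) (inj₁ q) = inj₂ (proj₁ (,-injective (trans (sym q) p)))
  Joins-endpoint (inj₂ p) (inj₂ q) = inj₁ (proj₂ (,-injective (trans (sym q) p)))

  Joins-other : Joins G e u w → Joins G e u x → w ≡ x
  Joins-other (inj₁ p) (inj₁ q) = proj₂ (,-injective (trans (sym p) q))
  Joins-other (inj₂ p) (inj₂ q) = proj₁ (,-injective (trans (sym p) q))
  Joins-other (inj₁ p) (inj₂ q) with refl , refl ← ,-injective (trans (sym p) q) = refl
  Joins-other (inj₂ p) (inj₁ q) with refl , refl ← ,-injective (trans (sym p) q) = refl

  head∈verts : (p : Walk G u v) → u ∈ verts G p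
  head∈verts []           = here refl
  head∈verts (step _ _ _) = here refl

  last∈verts : (p : Walk G u v) → v ∈ verts G p
  last∈verts []           = here refl
  last∈verts (step _ _ q) = there (last∈verts q)

  endpoint∈verts : (p : Walk G u v) → e ∈ edges G p → Joins G e a b → a ∈ verts G p
  endpoint∈verts (step _ j q) (here refl) j′ with Joins-endpoint j j′
  ... | inj₁ refl = here refl
  ... | inj₂ refl = there (head∈verts q)
  endpoint∈verts (step _ _ q) (there e∈q) j′ = there (endpoint∈verts q e∈q j′)

  IsPath⇒≢ : (j : Joins G e u w) (q : Walk G w v) → IsPath G (step e j q) → u ≢ v
  IsPath⇒≢ _ q simple refl = Unique[x∷xs]⇒x∉xs simple (last∈verts q)

  rest-avoids-start : (j : Joins G e u w) (q : Walk G w v) → IsPath G (step e j q) →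
                      e′ ∈ edges G q → ¬ Joins G e′ u a
  rest-avoids-start _ q simple e′∈q j′ = Unique[x∷xs]⇒x∉xs simple (endpoint∈verts q e′∈q j′)

  IsPath⇒Unique-edges : (p : Walk G u v) → IsPath G p → Unique (edges G p)
  IsPath⇒Unique-edges []           _      = []
  IsPath⇒Unique-edges (step _ j q) simple =
    All.tabulate (λ { e∈q refl → rest-avoids-start j q simple e∈q j })
    ∷ IsPath⇒Unique-edges q (Unique-tail simple)

  edge∈path⇒≢ : (p : Walk G u v) → IsPath G p → e ∈ edges G p → u ≢ v
  edge∈path⇒≢ (step _ j q) simple _ = IsPath⇒≢ j q simple

  edge-at-start-unique : (p : Walk G u v) → IsPath G p → e ∈ edges G p → e′ ∈ edges G p →
                         Joins G e u a → Joins G e′ u b → e ≡ e′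
  edge-at-start-unique (step _ _ _) _      (here refl) (here refl) _ _ = refl
  edge-at-start-unique (step _ j q) simple (here refl) (there e′∈q) _ j′ =
    ⊥-elim (rest-avoids-start j q simple e′∈q j′)
  edge-at-start-unique (step _ j q) simple (there e∈q) _ je _ =
    ⊥-elim (rest-avoids-start j q simple e∈q je)

  first-edge-avoids-end : (j : Joins G e u w) (j′ : Joins G e′ w x) (q : Walk G x v) →
                          IsPath G (step e j (step e′ j′ q)) → ¬ Joins G e v a
  first-edge-avoids-end j j′ q simple jv with Joins-endpoint j jv
  ... | inj₁ refl = IsPath⇒≢ j (step _ j′ q) simple refl
  ... | inj₂ refl = IsPath⇒≢ j′ q (Unique-tail simple) refl

  edge-at-end-unique : (p : Walk G u v) → IsPath G p → e ∈ edges G p → e′ ∈ edges G p →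
                       Joins G e v a → Joins G e′ v b → e ≡ e′
  edge-at-end-unique (step _ _ []) _ (here refl) (here refl) _ _ = refl
  edge-at-end-unique (step _ j (step _ j′ q)) simple (here refl) _ jv _ =
    ⊥-elim (first-edge-avoids-end j j′ q simple jv)
  edge-at-end-unique (step _ j (step _ j′ q)) simple (there _) (here refl) _ jv =
    ⊥-elim (first-edge-avoids-end j j′ q simple jv)
  edge-at-end-unique (step _ _ q@(step _ _ _)) simple (there e∈q) (there e′∈q) jv j′v =
    edge-at-end-unique q (Unique-tail simple) e∈q e′∈q jv j′v

  EdgeAt : (E G → Set) → V G → Set
  EdgeAt H x = ∃₂ λ e′ y → H e′ × Joins G e′ x y

  edge-at-start : u ≢ v → (p : Walk G u v) → EdgeAt (_∈ edges G p) u
  edge-at-start u≢v []           = ⊥-elim (u≢v refl)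
  edge-at-start _   (step e j _) = e , _ , here refl , j

  edge-at-interior-paired : (p : Walk G u v) → IsPath G p → e ∈ edges G p → Joins G e x y →
                            x ≢ u → x ≢ v → EdgeAt (λ e′ → e′ ≢ e × e′ ∈ edges G p) x
  edge-at-interior-paired (step _ j q) simple (here refl) jx x≢u x≢v with Joins-endpoint j jx
  ... | inj₁ refl = ⊥-elim (x≢u refl)
  ... | inj₂ refl with e′ , y , e′∈q , j′ ← edge-at-start x≢v q =
    e′ , y , ((λ { refl → rest-avoids-start j q simple e′∈q j }) , there e′∈q) , j′
  edge-at-interior-paired {x = x} (step {w = w} e₁ j q) simple (there e∈q) jx x≢u x≢v with x ≟ w
  ... | yes refl =
    e₁ , _ , ((λ { refl → rest-avoids-start j q simple e∈q j }) , here refl) , Joins-sym j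
  ... | no x≢w
    with e′ , y , (e′≢e , e′∈q) , j′ ← edge-at-interior-paired q (Unique-tail simple) e∈q jx x≢w x≢v =
    e′ , y , (e′≢e , there e′∈q) , j′

  first-edge-at⇒no-two-more : (j : Joins G e u w) (q : Walk G w v) → IsPath G (step e j q) →
                              Joins G e x y → e₂ ≢ e₃ → e₂ ∈ edges G q → e₃ ∈ edges G q →
                              Joins G e₂ x y₂ → Joins G e₃ x y₃ → ⊥
  first-edge-at⇒no-two-more j q simple jx e₂≢e₃ e₂∈q e₃∈q j₂ j₃ with Joins-endpoint j jx
  ... | inj₁ refl = rest-avoids-start j q simple e₂∈q j₂
  ... | inj₂ refl = e₂≢e₃ (edge-at-start-unique q (Unique-tail simple) e₂∈q e₃∈q j₂ j₃)

  no-three-edges-at : (p : Walk G u v) → IsPath G p →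
                      e₁ ≢ e₂ → e₁ ≢ e₃ → e₂ ≢ e₃ →
                      e₁ ∈ edges G p → e₂ ∈ edges G p → e₃ ∈ edges G p →
                      Joins G e₁ x y₁ → Joins G e₂ x y₂ → Joins G e₃ x y₃ → ⊥
  no-three-edges-at (step _ j q) simple _ _ e₂≢e₃ (here refl) (there e₂∈q) (there e₃∈q) j₁ j₂ j₃ =
    first-edge-at⇒no-two-more j q simple j₁ e₂≢e₃ e₂∈q e₃∈q j₂ j₃
  no-three-edges-at (step _ j q) simple _ e₁≢e₃ _ (there e₁∈q) (here refl) (there e₃∈q) j₁ j₂ j₃ =
    first-edge-at⇒no-two-more j q simple j₂ e₁≢e₃ e₁∈q e₃∈q j₁ j₃
  no-three-edges-at (step _ j q) simple e₁≢e₂ _ _ (there e₁∈q) (there e₂∈q) (here refl) j₁ j₂ j₃ =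
    first-edge-at⇒no-two-more j q simple j₃ e₁≢e₂ e₁∈q e₂∈q j₁ j₂
  no-three-edges-at (step _ _ q) simple e₁≢e₂ e₁≢e₃ e₂≢e₃
                    (there e₁∈q) (there e₂∈q) (there e₃∈q) =
    no-three-edges-at q (Unique-tail simple) e₁≢e₂ e₁≢e₃ e₂≢e₃ e₁∈q e₂∈q e₃∈q
  no-three-edges-at (step _ _ _) _ e₁≢e₂ _ _ (here refl) (here refl) _ _ _ _ = e₁≢e₂ refl
  no-three-edges-at (step _ _ _) _ _ e₁≢e₃ _ (here refl) _ (here refl) _ _ _ = e₁≢e₃ refl
  no-three-edges-at (step _ _ _) _ _ _ e₂≢e₃ _ (here refl) (here refl) _ _ _ = e₂≢e₃ refl

  step-edge-at-end : (j : Joins G e u w) (q : Walk G w v) → EdgeAt (_∈ edges G (step e j q)) v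
  step-edge-at-end {e = e} j [] = e , _ , here refl , Joins-sym j
  step-edge-at-end j (step _ j′ q) with e′ , y , e′∈q , j″ ← step-edge-at-end j′ q =
    e′ , y , there e′∈q , j″

  edge-at-end : u ≢ v → (p : Walk G u v) → EdgeAt (_∈ edges G p) v
  edge-at-end u≢v []           = ⊥-elim (u≢v refl)
  edge-at-end _   (step _ j q) = step-edge-at-end j q

  SymDiff : List (E G) → List (E G) → E G → Set
  SymDiff xs ys e = (e ∈ xs × e ∉ ys) ⊎ (e ∉ xs × e ∈ ys)

  SymDiff-sym : ∀ {xs ys} → SymDiff xs ys e → SymDiff ys xs e
  SymDiff-sym (inj₁ (e∈xs , e∉ys)) = inj₂ (e∉ys , e∈xs)
  SymDiff-sym (inj₂ (e∉xs , e∈ys)) = inj₁ (e∈ys , e∉xs)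

  Leafless : (E G → Set) → Set
  Leafless H = ∀ {e x y} → H e → Joins G e x y → EdgeAt (λ e′ → e′ ≢ e × H e′) x

  module _ (P Q : Walk G s t) (simpleP : IsPath G P) (simpleQ : IsPath G Q) where
    private
      D : E G → Set
      D = SymDiff (edges G P) (edges G Q)

    SymDiff-edge-at-terminal :
      (∀ {e e′ a b} → e ∈ edges G P → e′ ∈ edges G P → Joins G e x a → Joins G e′ x b → e ≡ e′) →
      EdgeAt (_∈ edges G Q) x → e ∈ edges G P → e ∉ edges G Q → Joins G e x y →
      EdgeAt (λ e′ → e′ ≢ e × D e′) x
    SymDiff-edge-at-terminal P-unique-at-x (g , y , g∈Q , jg) e∈P e∉Q j with g ∈? edges G P
    ... | yes g∈P = ⊥-elim (e∉Q (subst (_∈ edges G Q) (sym (P-unique-at-x e∈P g∈P j jg)) g∈Q))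
    ... | no g∉P  = g , y , ((λ { refl → e∉Q g∈Q }) , inj₂ (g∉P , g∈Q)) , jg

    SymDiff-edge-at-interior : e ∈ edges G P → e ∉ edges G Q → Joins G e x y → x ≢ s → x ≢ t →
                               EdgeAt (λ e′ → e′ ≢ e × D e′) x
    SymDiff-edge-at-interior e∈P e∉Q j x≢s x≢t
      with edge-at-interior-paired P simpleP e∈P j x≢s x≢t
    ... | e″ , y″ , (e″≢e , e″∈P) , j″ with e″ ∈? edges G Q
    ...   | no e″∉Q = e″ , y″ , (e″≢e , inj₁ (e″∈P , e″∉Q)) , j″
    ...   | yes e″∈Q with edge-at-interior-paired Q simpleQ e″∈Q j″ x≢s x≢t
    ...     | g , yg , (g≢e″ , g∈Q) , jg with g ∈? edges G P
    ...       | no g∉P  = g , yg , ((λ { refl → e∉Q g∈Q }) , inj₂ (g∉P , g∈Q)) , jg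
    ...       | yes g∈P = ⊥-elim (no-three-edges-at P simpleP (≢-sym e″≢e) (λ { refl → e∉Q g∈Q })
                                    (≢-sym g≢e″) e∈P e″∈P g∈P j j″ jg)

    SymDiff-edge-paired : e ∈ edges G P → e ∉ edges G Q → Joins G e x y →
                          EdgeAt (λ e′ → e′ ≢ e × D e′) x
    SymDiff-edge-paired {x = x} e∈P e∉Q j with x ≟ s | x ≟ t
    ... | yes refl | _ = SymDiff-edge-at-terminal (edge-at-start-unique P simpleP)
                           (edge-at-start (edge∈path⇒≢ P simpleP e∈P) Q) e∈P e∉Q j
    ... | no _ | yes refl = SymDiff-edge-at-terminal (edge-at-end-unique P simpleP)
                              (edge-at-end (edge∈path⇒≢ P simpleP e∈P) Q) e∈P e∉Q j
    ... | no x≢s | no x≢t = SymDiff-edge-at-interior e∈P e∉Q j x≢s x≢t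

  SymDiff-leafless : (P Q : Walk G s t) → IsPath G P → IsPath G Q →
                     Leafless (SymDiff (edges G P) (edges G Q))
  SymDiff-leafless P Q simpleP simpleQ (inj₁ (e∈P , e∉Q)) j =
    SymDiff-edge-paired P Q simpleP simpleQ e∈P e∉Q j
  SymDiff-leafless P Q simpleP simpleQ (inj₂ (e∉P , e∈Q)) j
    with e′ , y , (e′≢e , De′) , j′ ← SymDiff-edge-paired Q P simpleQ simpleP e∈Q e∉P j =
    e′ , y , (e′≢e , SymDiff-sym De′) , j′

  prefix : (p : Walk G u v) → x ∈ verts G p → Walk G u x
  prefix []           (here refl) = []
  prefix (step _ _ _) (here refl) = []
  prefix (step e j q) (there x∈q) = step e j (prefix q x∈q)

  prefix-verts⊆ : (p : Walk G u v) (x∈p : x ∈ verts G p) → verts G (prefix p x∈p) ⊆ verts G p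
  prefix-verts⊆ []           (here refl) y∈              = y∈
  prefix-verts⊆ (step _ _ _) (here refl) (here refl)     = here refl
  prefix-verts⊆ (step _ _ _) (there _)   (here refl)     = here refl
  prefix-verts⊆ (step _ _ q) (there x∈q) (there y∈prefix) = there (prefix-verts⊆ q x∈q y∈prefix)

  prefix-edges⊆ : (p : Walk G u v) (x∈p : x ∈ verts G p) → edges G (prefix p x∈p) ⊆ edges G p
  prefix-edges⊆ []           (here refl) ()
  prefix-edges⊆ (step _ _ _) (here refl) ()
  prefix-edges⊆ (step _ _ _) (there _)   (here refl)      = here refl
  prefix-edges⊆ (step _ _ q) (there x∈q) (there e∈prefix) = there (prefix-edges⊆ q x∈q e∈prefix)

  prefix-IsPath : (p : Walk G u v) (x∈p : x ∈ verts G p) → IsPath G p → IsPath G (prefix p x∈p)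
  prefix-IsPath []           (here refl) simple             = simple
  prefix-IsPath (step _ _ _) (here refl) _                  = [] ∷ []
  prefix-IsPath (step _ _ q) (there x∈q) (u∉q ∷ simple-q) =
    anti-mono (prefix-verts⊆ q x∈q) u∉q ∷ prefix-IsPath q x∈q simple-q

  close-cycle : (j : Joins G e u w) (q : Walk G w v) → IsPath G (step e j q) →
                e′ ≢ e → (j′ : Joins G e′ u y) (y∈p : y ∈ verts G (step e j q)) →
                IsCycle G (step e′ (Joins-sym j′) (prefix (step e j q) y∈p))
  close-cycle j q simple e′≢e j′ y∈p =
    (¬Any⇒All¬ _ e′∉prefix ∷ IsPath⇒Unique-edges _ prefix-simple) , prefix-simple
    where
      prefix-simple : IsPath G (prefix (step _ j q) y∈p)
      prefix-simple = prefix-IsPath (step _ j q) y∈p simple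
      e′∉prefix : _ ∉ edges G (prefix (step _ j q) y∈p)
      e′∉prefix e′∈prefix with prefix-edges⊆ (step _ j q) y∈p e′∈prefix
      ... | here e′≡e   = e′≢e e′≡e
      ... | there e′∈q = rest-avoids-start j q simple e′∈q j′

  HasCycleIn : (E G → Set) → Set
  HasCycleIn H = ∃ λ u → Σ (Walk G u u) λ c → IsCycle G c × All H (edges G c)

  module _ {H : E G → Set} (leafless : Leafless H) where
    -- Walk backwards along H-edges until reaching a vertex already visited; a
    -- simple walk has at most n vertices, which bounds the number of steps.
    extend : (fuel : ℕ) (j : Joins G e u w) (q : Walk G w v) → IsPath G (step e j q) →
             All H (edges G (step e j q)) → n < fuel + length (verts G (step e j q)) → HasCycleIn H
    extend zero    _ _ simple _ n< = ⊥-elim (<⇒≱ n< (Unique-length≤ simple))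
    extend (suc k) j q simple all-H n<
      with leafless (All.head all-H) j
    ... | e′ , y , (e′≢e , He′) , j′ with y ∈? verts G (step _ j q)
    ...   | yes y∈p = y , step _ (Joins-sym j′) (prefix (step _ j q) y∈p)
                  , close-cycle j q simple e′≢e j′ y∈p
                  , He′ ∷ anti-mono (prefix-edges⊆ (step _ j q) y∈p) all-H
    ...   | no y∉p  = extend k (Joins-sym j′) (step _ j q) (¬Any⇒All¬ _ y∉p ∷ simple) (He′ ∷ all-H)
                        (subst (n <_) (sym (+-suc k _)) n<)

    Leafless⇒HasCycleIn : H e → HasCycleIn H
    Leafless⇒HasCycleIn {e = e} He with ends e in ends≡
    ... | a , b with a ≟ b
    ...   | yes refl = a , step e (inj₁ ends≡) [] , ([] ∷ [] , [] ∷ []) , He ∷ []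
    ...   | no a≢b   = extend n (inj₁ ends≡) [] ((a≢b ∷ []) ∷ [] ∷ []) (He ∷ []) (m<m+n n z<s)

  edges-⊆⇒≡ : (p q : Walk G u v) → IsPath G p → IsPath G q →
              edges G p ⊆ edges G q → edges G p ≡ edges G q
  edges-⊆⇒≡ []           []           _      _      _ = refl
  edges-⊆⇒≡ []           (step _ j q) _      simple _ = ⊥-elim (IsPath⇒≢ j q simple refl)
  edges-⊆⇒≡ (step _ j p) []           simple _      _ = ⊥-elim (IsPath⇒≢ j p simple refl)
  edges-⊆⇒≡ (step e j p) (step e′ j′ q) simpleP simpleQ p⊆q
    with edge-at-start-unique (step e′ j′ q) simpleQ (p⊆q (here refl)) (here refl) j j′
  ... | refl with Joins-other j j′
  ...   | refl = cong (e ∷_) (edges-⊆⇒≡ p q (Unique-tail simpleP) (Unique-tail simpleQ) tail⊆)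
    where
      tail⊆ : edges G p ⊆ edges G q
      tail⊆ e″∈p with p⊆q (there e″∈p)
      ... | here refl   = ⊥-elim (rest-avoids-start j p simpleP e″∈p j)
      ... | there e″∈q = e″∈q

  ∈-trace : ∀ {T} (p : Walk G u v) → e ∈ edges G p → e Subset.∈ T → e ∈ trace G T p
  ∈-trace {T = T} _ = ∈-filter⁺ (_∈?ₛ T)

  trace⊆edges : ∀ {T} (p : Walk G u v) → trace G T p ⊆ edges G p
  trace⊆edges {T = T} _ e∈trace = proj₁ (∈-filter⁻ (_∈?ₛ T) e∈trace)

  trace-≡⇒SymDiff-∉ : ∀ {T} (P Q : Walk G s t) → trace G T P ≡ trace G T Q →
                      SymDiff (edges G P) (edges G Q) e → e Subset.∉ T
  trace-≡⇒SymDiff-∉ P Q same-trace (inj₁ (e∈P , e∉Q)) e∈T =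
    e∉Q (trace⊆edges Q (subst (_ ∈_) same-trace (∈-trace P e∈P e∈T)))
  trace-≡⇒SymDiff-∉ P Q same-trace (inj₂ (e∉P , e∈Q)) e∈T =
    e∉P (trace⊆edges P (subst (_ ∈_) (sym same-trace) (∈-trace Q e∈Q e∈T)))

lemma13 : (G : Graph) (s t : V G) → Covered G s t →
    (F : Subset (Graph.m G)) → FeedbackEdgeSet G F →
    TrackingEdgeSet G F s t
lemma13 G s t _ F feedback (path P simpleP) (path Q simpleQ) P≢Q same-trace =
  P≢Q (edges-⊆⇒≡ G P Q simpleP simpleQ P⊆Q)
  where
    D : E G → Set
    D = SymDiff G (edges G P) (edges G Q)

    D-empty : ∀ {e} → ¬ D e
    D-empty De
      with _ , c , c-cycle , c⊆D ← Leafless⇒HasCycleIn G (SymDiff-leafless G P Q simpleP simpleQ) De =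
      feedback c c-cycle (All.map (trace-≡⇒SymDiff-∉ G P Q same-trace) c⊆D)

    P⊆Q : edges G P ⊆ edges G Q
    P⊆Q {e} e∈P with e ∈? edges G Q
    ... | yes e∈Q = e∈Q
    ... | no e∉Q  = ⊥-elim (D-empty (inj₁ (e∈P , e∉Q)))
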